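{- Let $k$ be a natural number that is odd or divisible by $4$, and let $H$ be an oriented graph on $n$ vertices whose underlying undirected graph is bipartite, with minimum semidegree $\delta^0(H)>n/k$. Then there are natural numbers $a\neq b$ with $a+b<k$ such that $H$ contains a closed walk of length $a+b$ with $a$ edges oriented forwards and $b$ edges oriented backwards.
   Context: An oriented graph is a directed graph obtained from a simple undirected graph by orienting each edge. The minimum semidegree $\delta^0(H)$ is the minimum of the minimum outdegree and minimum indegree of $H$. A closed walk of length $m$ is a sequence of vertices $v_0,\dots,v_m=v_0$ such that consecutive vertices are joined by an edge of $H$ (in either direction); an edge is oriented forwards if it goes from $v_{i-1}$ to $v_i$ and backwards otherwise. Natural numbers include $0$. -}

module Defs where

open import Data.Nat using (ℕ; zero; suc; _+_; _*_; _<_)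
open import Data.Fin using (Fin)
open import Data.Bool using (Bool)
open import Data.Product using (Σ; _×_; ∃)
open import Relation.Nullary using (¬_; Dec)
open import Relation.Unary using (Decidable)
open import Relation.Binary.PropositionalEquality using (_≡_; _≢_)
open import Data.Fin.Properties using (any?)
import Data.Fin.Subset as S
open import Data.Vec using (tabulate)
open import Data.Bool using (true; false)
open import Relation.Nullary.Decidable using (⌊_⌋)

record OrientedGraph (n : ℕ) : Set₁ where
  field
    Arc    : Fin n → Fin n → Set
    arc?   : ∀ u v → Dec (Arc u v)
    irrefl : ∀ u → ¬ Arc u u
    antisym : ∀ u v → Arc u v → ¬ Arc v u

open OrientedGraph public

outNbhd : ∀ {n} → OrientedGraph n → Fin n → S.Subset n
outNbhd H u = tabulate (λ v → ⌊ arc? H u v ⌋)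

inNbhd : ∀ {n} → OrientedGraph n → Fin n → S.Subset n
inNbhd H v = tabulate (λ u → ⌊ arc? H u v ⌋)

outdeg : ∀ {n} → OrientedGraph n → Fin n → ℕ
outdeg H u = S.∣ outNbhd H u ∣

indeg : ∀ {n} → OrientedGraph n → Fin n → ℕ
indeg H u = S.∣ inNbhd H u ∣

Bipartite : ∀ {n} → OrientedGraph n → Set
Bipartite {n} H = Σ (Fin n → Bool) λ c → ∀ u v → Arc H u v → c u ≢ c v

-- δ⁰(H) > n / k, written without division (k > 0): every in- and outdegree d
-- satisfies n < k * d.
SemidegreeAbove : ∀ {n} → OrientedGraph n → ℕ → Set
SemidegreeAbove {n} H k = ∀ u → (n < k * outdeg H u) × (n < k * indeg H u)

data Walk {n} (H : OrientedGraph n) : ℕ → ℕ → Fin n → Fin n → Set where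
  stop : ∀ u → Walk H 0 0 u u
  fwd  : ∀ {a b u v w} → Arc H u v → Walk H a b v w → Walk H (suc a) b u w
  bwd  : ∀ {a b u v w} → Arc H v u → Walk H a b v w → Walk H a (suc b) u w

HasClosedWalk : ∀ {n} → OrientedGraph n → ℕ → ℕ → Set
HasClosedWalk {n} H a b = Σ (Fin n) λ v → Walk H a b v v

-- Recolour so that the colour class B of `true` has at most n/2 vertices, and
-- start from a vertex v coloured `false`.  Following 2s out-arcs from v ends at
-- a vertex x coloured like v, so every out-neighbour of x lies in B and is
-- reached from v by a walk with 2s + 1 forward edges; dually with in-arcs.
-- With m = ⌈k/2⌉, take ⌈m/2⌉ such forward rays and ⌊m/2⌋ backward rays.  Their
-- end sets have more than n/k vertices each and all lie in B, and
-- m · n/k ≥ n/2 ≥ |B|, so two of them meet in some w.  Going out to w along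
-- one ray and back along the other is a closed walk whose numbers of forward
-- and backward edges differ and add up to less than k.
module Submission where

open import Defs
open import Data.Nat using (ℕ; _+_; _*_; _<_; NonZero)
open import Data.Nat.Divisibility using (_∣_)
open import Relation.Nullary using (¬_)
open import Data.Product using (Σ; _×_)
open import Data.Sum using (_⊎_)
open import Relation.Binary.PropositionalEquality using (_≢_)

open import Data.Nat using (zero; suc; _≤_; z≤n; s≤s; _∸_; _≤?_; ⌊_/2⌋; ⌈_/2⌉; >-nonZero⁻¹)
open import Data.Nat.Properties
open import Data.Nat.ListAction using (sum)
open import Data.Bool using (Bool; true; false; not)
open import Data.Bool.Properties using (¬-not; not-injective; not-involutive; T-≡)
import Data.Bool as Bool
open import Data.Fin using (Fin)
open import Data.Fin.Subset using (Subset; inside; outside; _∈_; _∩_; _∪_; ⋃; ∁; ∣_∣; Nonempty; Empty; _⊆_)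
open import Data.Fin.Subset.Properties
  using (drop-∷-Empty; nonempty?; x∈p∪q⁻; x∈p∩q⁺; x∈p∩q⁻; ∉⊥; p⊆q⇒∣p∣≤∣q∣; ∣p∣≤n; ∣∁p∣≡n∸∣p∣)
open import Data.Vec using ([]; _∷_; tabulate; here; there)
open import Data.Vec.Properties using (lookup∘tabulate; []=⇒lookup; lookup⇒[]=; tabulate-∘)
open import Data.List using (List; []; _∷_; map; length; _++_; applyUpTo)
open import Data.List.Properties using (length-++; length-applyUpTo)
open import Data.List.Relation.Unary.Any as Any using (Any; here; there)
import Data.List.Relation.Unary.All as All
import Data.List.Relation.Unary.All.Properties as Allₚ
open import Data.List.Relation.Unary.AllPairs using (AllPairs; []; _∷_)
import Data.List.Relation.Unary.AllPairs.Properties as AllPairsₚ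
open import Data.Product using (_,_; proj₁; proj₂)
open import Data.Sum using (inj₁; inj₂)
open import Data.Empty using (⊥-elim)
open import Relation.Nullary using (yes; no)
open import Relation.Nullary.Decidable using (toWitness)
open import Relation.Binary.PropositionalEquality
  using (_≡_; refl; sym; trans; cong; cong₂; subst; ≢-sym; module ≡-Reasoning)
open import Function using (_∘_)
open import Function.Bundles using (module Equivalence)
open import Data.Nat.Tactic.RingSolver using (solve-∀)

∈tabulate⁺ : ∀ {n} {f : Fin n → Bool} {x} → f x ≡ true → x ∈ tabulate f
∈tabulate⁺ {f = f} {x} fx≡true = lookup⇒[]= x (tabulate f) (trans (lookup∘tabulate f x) fx≡true)

∈tabulate⁻ : ∀ {n} {f : Fin n → Bool} {x} → x ∈ tabulate f → f x ≡ true
∈tabulate⁻ {f = f} {x} x∈ = trans (sym (lookup∘tabulate f x)) ([]=⇒lookup x∈)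

∣p∣>0⇒Nonempty : ∀ {n} (p : Subset n) → 0 < ∣ p ∣ → Nonempty p
∣p∣>0⇒Nonempty (inside ∷ p) _ = Fin.zero , here
∣p∣>0⇒Nonempty (outside ∷ p) ∣p∣>0 with ∣p∣>0⇒Nonempty p ∣p∣>0
... | x , x∈p = Fin.suc x , there x∈p

Empty[p∩q]⇒∣p∣+∣q∣≤∣p∪q∣ : ∀ {n} (p q : Subset n) → Empty (p ∩ q) → ∣ p ∣ + ∣ q ∣ ≤ ∣ p ∪ q ∣
Empty[p∩q]⇒∣p∣+∣q∣≤∣p∪q∣ [] [] _ = z≤n
Empty[p∩q]⇒∣p∣+∣q∣≤∣p∪q∣ (inside ∷ p) (inside ∷ q) empty = ⊥-elim (empty (Fin.zero , here))
Empty[p∩q]⇒∣p∣+∣q∣≤∣p∪q∣ (inside ∷ p) (outside ∷ q) empty =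
  s≤s (Empty[p∩q]⇒∣p∣+∣q∣≤∣p∪q∣ p q (drop-∷-Empty empty))
Empty[p∩q]⇒∣p∣+∣q∣≤∣p∪q∣ (outside ∷ p) (inside ∷ q) empty rewrite +-suc ∣ p ∣ ∣ q ∣ =
  s≤s (Empty[p∩q]⇒∣p∣+∣q∣≤∣p∪q∣ p q (drop-∷-Empty empty))
Empty[p∩q]⇒∣p∣+∣q∣≤∣p∪q∣ (outside ∷ p) (outside ∷ q) empty =
  Empty[p∩q]⇒∣p∣+∣q∣≤∣p∪q∣ p q (drop-∷-Empty empty)

module _ {n} {I : Set} (S : I → Subset n) where

  ∈⋃⁻ : ∀ {w} L → w ∈ ⋃ (map S L) → Any (λ y → w ∈ S y) L
  ∈⋃⁻ [] w∈ = ⊥-elim (∉⊥ w∈)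
  ∈⋃⁻ (y ∷ L) w∈ with x∈p∪q⁻ (S y) (⋃ (map S L)) w∈
  ... | inj₁ w∈Sy = here w∈Sy
  ... | inj₂ w∈⋃ = there (∈⋃⁻ L w∈⋃)

  ⋃-⊆ : ∀ {B} → (∀ x → S x ⊆ B) → ∀ L → ⋃ (map S L) ⊆ B
  ⋃-⊆ S⊆B L w∈ with Any.satisfied (∈⋃⁻ L w∈)
  ... | y , w∈Sy = S⊆B y w∈Sy

  meet⊎∑∣S∣≤∣⋃S∣ : ∀ {R : I → I → Set} L → AllPairs R L →
    (Σ I λ x → Σ I λ y → R x y × Nonempty (S x ∩ S y)) ⊎ sum (map (∣_∣ ∘ S) L) ≤ ∣ ⋃ (map S L) ∣
  meet⊎∑∣S∣≤∣⋃S∣ [] [] = inj₂ z≤n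
  meet⊎∑∣S∣≤∣⋃S∣ (x ∷ L) (Rx ∷ pairs) with meet⊎∑∣S∣≤∣⋃S∣ L pairs
  ... | inj₁ meet = inj₁ meet
  ... | inj₂ ∑≤ with nonempty? (S x ∩ ⋃ (map S L))
  ...   | no empty = inj₂ (≤-trans (+-monoʳ-≤ ∣ S x ∣ ∑≤) (Empty[p∩q]⇒∣p∣+∣q∣≤∣p∪q∣ (S x) _ empty))
  ...   | yes (w , w∈) with x∈p∩q⁻ (S x) _ w∈
  ...     | w∈Sx , w∈⋃ with All.lookupAny Rx (∈⋃⁻ L w∈⋃)
  ...       | Rxy , w∈Sy = inj₁ (x , _ , Rxy , w , x∈p∩q⁺ (w∈Sx , w∈Sy))

length*1+m≤k*sum : ∀ {I : Set} {m} k (f : I → ℕ) → (∀ x → m < k * f x) →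
  ∀ L → length L * suc m ≤ k * sum (map f L)
length*1+m≤k*sum k f large [] = z≤n
length*1+m≤k*sum {m = m} k f large (x ∷ L) = begin
  suc m + length L * suc m  ≤⟨ +-mono-≤ (large x) (length*1+m≤k*sum k f large L) ⟩
  k * f x + k * sum (map f L) ≡⟨ *-distribˡ-+ k (f x) (sum (map f L)) ⟨
  k * (f x + sum (map f L))   ∎
  where open ≤-Reasoning

module _ {n} {H : OrientedGraph n} where

  snocᶠ : ∀ {a b u x w} → Walk H a b u x → Arc H x w → Walk H (suc a) b u w
  snocᶠ (stop _) e = fwd e (stop _)
  snocᶠ (fwd e′ W) e = fwd e′ (snocᶠ W e)
  snocᶠ (bwd e′ W) e = bwd e′ (snocᶠ W e)

  snocᵇ : ∀ {a b u x w} → Walk H a b u x → Arc H w x → Walk H a (suc b) u w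
  snocᵇ (stop _) e = bwd e (stop _)
  snocᵇ (fwd e′ W) e = fwd e′ (snocᵇ W e)
  snocᵇ (bwd e′ W) e = bwd e′ (snocᵇ W e)

  _++ʷ_ : ∀ {a b c d u v w} → Walk H a b u v → Walk H c d v w → Walk H (a + c) (b + d) u w
  stop _ ++ʷ W = W
  fwd e V ++ʷ W = fwd e (V ++ʷ W)
  bwd e V ++ʷ W = bwd e (V ++ʷ W)

  reverseʷ : ∀ {a b u v} → Walk H a b u v → Walk H b a v u
  reverseʷ (stop _) = stop _
  reverseʷ (fwd e W) = snocᵇ (reverseʷ W) e
  reverseʷ (bwd e W) = snocᶠ (reverseʷ W) e

_ᵒᵖ : ∀ {n} → OrientedGraph n → OrientedGraph n
H ᵒᵖ = record
  { Arc = λ u v → Arc H v u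
  ; arc? = λ u v → arc? H v u
  ; irrefl = irrefl H
  ; antisym = λ u v → antisym H v u
  }

fromᵒᵖ : ∀ {n} {H : OrientedGraph n} {a b u w} → Walk (H ᵒᵖ) a b u w → Walk H b a u w
fromᵒᵖ (stop u) = stop u
fromᵒᵖ (fwd e W) = bwd e (fromᵒᵖ W)
fromᵒᵖ (bwd e W) = fwd e (fromᵒᵖ W)

∈outNbhd⇒Arc : ∀ {n} (H : OrientedGraph n) {u w} → w ∈ outNbhd H u → Arc H u w
∈outNbhd⇒Arc H w∈ = toWitness (Equivalence.from T-≡ (∈tabulate⁻ w∈))

m<k*n⇒0<n : ∀ {m} k n → m < k * n → 0 < n
m<k*n⇒0<n {m} k zero m<k*0 = ⊥-elim (n≮0 (subst (m <_) (*-zeroʳ k) m<k*0))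
m<k*n⇒0<n k (suc n) _ = s≤s z≤n

outNeighbour : ∀ {n} k (H : OrientedGraph n) {u} → n < k * outdeg H u → Σ (Fin n) (Arc H u)
outNeighbour k H {u} n<k*d
  with w , w∈ ← ∣p∣>0⇒Nonempty (outNbhd H u) (m<k*n⇒0<n k _ n<k*d)
  = w , ∈outNbhd⇒Arc H w∈

module Colouring {n} (G : OrientedGraph n) (c : Fin n → Bool)
  (proper : ∀ u v → Arc G u v → c u ≢ c v) where

  arc-flips : ∀ {u v} → Arc G u v → c v ≡ not (c u)
  arc-flips {u} {v} e = ¬-not (proper u v e ∘ sym)

  module _ (out : ∀ u → Σ (Fin n) (Arc G u)) where

    colour-exists : Fin n → ∀ β → Σ (Fin n) λ v → c v ≡ β
    colour-exists u β with c u Bool.≟ β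
    ... | yes cu≡β = u , cu≡β
    ... | no cu≢β = proj₁ (out u) , (begin
      c (proj₁ (out u))  ≡⟨ arc-flips (proj₂ (out u)) ⟩
      not (c u)          ≡⟨ cong not (¬-not cu≢β) ⟩
      not (not β)        ≡⟨ not-involutive β ⟩
      β                  ∎)
      where open ≡-Reasoning

    evenWalk : ∀ s u → Σ (Fin n) λ x → Walk G (s * 2) 0 u x × c x ≡ c u
    evenWalk zero u = u , stop u , refl
    evenWalk (suc s) u =
      let y , u→y = out u
          z , y→z = out y
          x , z⇝x , cx≡cz = evenWalk s z
      in x , fwd u→y (fwd y→z z⇝x) , (begin
        c x               ≡⟨ cx≡cz ⟩
        c z               ≡⟨ arc-flips y→z ⟩
        not (c y)         ≡⟨ cong not (arc-flips u→y) ⟩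
        not (not (c u))   ≡⟨ not-involutive (c u) ⟩
        c u               ∎)
      where open ≡-Reasoning

    rayCentre : ℕ → Fin n → Fin n
    rayCentre s u = proj₁ (evenWalk s u)

    oddRay : ∀ s u {w} → w ∈ outNbhd G (rayCentre s u) → Walk G (suc (s * 2)) 0 u w
    oddRay s u w∈ = snocᶠ (proj₁ (proj₂ (evenWalk s u))) (∈outNbhd⇒Arc G w∈)

    oddRay-colour : ∀ s u {w} → w ∈ outNbhd G (rayCentre s u) → c w ≡ not (c u)
    oddRay-colour s u w∈ =
      trans (arc-flips (∈outNbhd⇒Arc G w∈)) (cong not (proj₂ (proj₂ (evenWalk s u))))

⌈n/2⌉≤1+⌊n/2⌋ : ∀ n → ⌈ n /2⌉ ≤ suc ⌊ n /2⌋
⌈n/2⌉≤1+⌊n/2⌋ zero = z≤n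
⌈n/2⌉≤1+⌊n/2⌋ (suc n) = s≤s (⌊n/2⌋≤⌈n/2⌉ n)

n≤⌈n/2⌉*2 : ∀ n → n ≤ ⌈ n /2⌉ * 2
n≤⌈n/2⌉*2 zero = z≤n
n≤⌈n/2⌉*2 (suc zero) = s≤s z≤n
n≤⌈n/2⌉*2 (suc (suc n)) = s≤s (s≤s (n≤⌈n/2⌉*2 n))

⌈n/2⌉*2≤1+n : ∀ n → ⌈ n /2⌉ * 2 ≤ suc n
⌈n/2⌉*2≤1+n zero = z≤n
⌈n/2⌉*2≤1+n (suc zero) = ≤-refl
⌈n/2⌉*2≤1+n (suc (suc n)) = s≤s (s≤s (⌈n/2⌉*2≤1+n n))

odd+odd<k : ∀ {i j m k} → suc i + suc j ≤ m → m * 2 ≤ suc k → suc (i * 2) + suc (j * 2) < k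
odd+odd<k {i} {j} {m} {k} bound budget = ≤-pred (begin
  suc (suc (suc (i * 2) + suc (j * 2))) ≡⟨ cong (suc ∘ suc) (+-suc (i * 2) (suc (j * 2))) ⟨
  suc i * 2 + suc j * 2                 ≡⟨ *-distribʳ-+ 2 (suc i) (suc j) ⟨
  (suc i + suc j) * 2                   ≤⟨ *-monoˡ-≤ 2 bound ⟩
  m * 2                                 ≤⟨ budget ⟩
  suc k                                 ∎)
  where open ≤-Reasoning

data Ray : Set where
  forward backward : ℕ → Ray

fwdSteps bwdSteps : Ray → ℕ
fwdSteps (forward s) = suc (s * 2)
fwdSteps (backward s) = 0
bwdSteps (forward s) = 0
bwdSteps (backward s) = suc (s * 2)

-- Out along r, back along r′.
Closable : ℕ → Ray → Ray → Set
Closable k r r′ = (fwdSteps r + bwdSteps r′ ≢ bwdSteps r + fwdSteps r′)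
                × (fwdSteps r + bwdSteps r′ + (bwdSteps r + fwdSteps r′) < k)

rays : ℕ → List Ray
rays m = applyUpTo forward ⌈ m /2⌉ ++ applyUpTo backward ⌊ m /2⌋

length-rays : ∀ m → length (rays m) ≡ m
length-rays m = begin
  length (rays m)     ≡⟨ length-++ (applyUpTo forward ⌈ m /2⌉) ⟩
  length (applyUpTo forward ⌈ m /2⌉) + length (applyUpTo backward ⌊ m /2⌋)
                      ≡⟨ cong₂ _+_ (length-applyUpTo forward ⌈ m /2⌉) (length-applyUpTo backward ⌊ m /2⌋) ⟩
  ⌈ m /2⌉ + ⌊ m /2⌋   ≡⟨ +-comm ⌈ m /2⌉ ⌊ m /2⌋ ⟩
  ⌊ m /2⌋ + ⌈ m /2⌉   ≡⟨ ⌊n/2⌋+⌈n/2⌉≡n m ⟩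
  m                   ∎
  where open ≡-Reasoning

module _ {k m : ℕ} (budget : m * 2 ≤ suc k) where

  forward-closable : ∀ {i j} → i < j → suc i + suc j ≤ m → Closable k (forward i) (forward j)
  forward-closable {i} {j} i<j bound rewrite +-identityʳ (i * 2) =
    <⇒≢ (s≤s (*-monoˡ-< 2 i<j)) , odd+odd<k bound budget

  backward-closable : ∀ {i j} → i < j → suc j + suc i ≤ m → Closable k (backward i) (backward j)
  backward-closable {i} {j} i<j bound rewrite +-identityʳ (i * 2) =
    ≢-sym (<⇒≢ (s≤s (*-monoˡ-< 2 i<j))) , odd+odd<k bound budget

  forward-backward-closable : ∀ {i j} → suc i + suc j ≤ m → Closable k (forward i) (backward j)
  forward-backward-closable {i} {j} bound rewrite +-identityʳ (i * 2 + suc (j * 2)) =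
    (λ ()) , odd+odd<k bound budget

  rays-closable : AllPairs (Closable k) (rays m)
  rays-closable = AllPairsₚ.++⁺
    (AllPairsₚ.applyUpTo⁺₁ forward ⌈ m /2⌉ λ i<j j<p → forward-closable i<j (forward-bound i<j j<p))
    (AllPairsₚ.applyUpTo⁺₁ backward ⌊ m /2⌋ λ i<j j<q → backward-closable i<j (backward-bound i<j j<q))
    (Allₚ.applyUpTo⁺₁ _ ⌈ m /2⌉ λ i<p → Allₚ.applyUpTo⁺₁ _ ⌊ m /2⌋ λ j<q →
      forward-backward-closable (cross-bound i<p j<q))
    where
    open ≤-Reasoning

    forward-bound : ∀ {i j} → i < j → j < ⌈ m /2⌉ → suc i + suc j ≤ m
    forward-bound {i} {j} i<j j<p = begin
      suc i + suc j      ≤⟨ +-mono-≤ i<j j<p ⟩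
      j + ⌈ m /2⌉        ≤⟨ +-monoˡ-≤ ⌈ m /2⌉ (≤-pred (≤-trans j<p (⌈n/2⌉≤1+⌊n/2⌋ m))) ⟩
      ⌊ m /2⌋ + ⌈ m /2⌉  ≡⟨ ⌊n/2⌋+⌈n/2⌉≡n m ⟩
      m                  ∎

    backward-bound : ∀ {i j} → i < j → j < ⌊ m /2⌋ → suc j + suc i ≤ m
    backward-bound {i} {j} i<j j<q = begin
      suc j + suc i      ≤⟨ +-mono-≤ j<q i<j ⟩
      ⌊ m /2⌋ + j        ≤⟨ +-monoʳ-≤ ⌊ m /2⌋ (≤-trans (<⇒≤ j<q) (⌊n/2⌋≤⌈n/2⌉ m)) ⟩
      ⌊ m /2⌋ + ⌈ m /2⌉  ≡⟨ ⌊n/2⌋+⌈n/2⌉≡n m ⟩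
      m                  ∎

    cross-bound : ∀ {i j} → i < ⌈ m /2⌉ → j < ⌊ m /2⌋ → suc i + suc j ≤ m
    cross-bound {i} {j} i<p j<q = begin
      suc i + suc j      ≤⟨ +-mono-≤ i<p j<q ⟩
      ⌈ m /2⌉ + ⌊ m /2⌋  ≡⟨ +-comm ⌈ m /2⌉ ⌊ m /2⌋ ⟩
      ⌊ m /2⌋ + ⌈ m /2⌉  ≡⟨ ⌊n/2⌋+⌈n/2⌉≡n m ⟩
      m                  ∎

minorityColouring : ∀ {n} (H : OrientedGraph n) → Bipartite H →
  Σ (Fin n → Bool) λ c → (∀ u v → Arc H u v → c u ≢ c v) × ∣ tabulate c ∣ + ∣ tabulate c ∣ ≤ n
minorityColouring {n} H (c , proper) with ∣ tabulate c ∣ + ∣ tabulate c ∣ ≤? n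
... | yes minority = c , proper , minority
... | no majority = not ∘ c , (λ u v e → proper u v e ∘ not-injective) , (begin
  ∣ tabulate (not ∘ c) ∣ + ∣ tabulate (not ∘ c) ∣  ≡⟨ cong (λ p → ∣ p ∣ + ∣ p ∣) (tabulate-∘ not c) ⟩
  ∣ ∁ T ∣ + ∣ ∁ T ∣                                ≡⟨ cong (λ t → t + t) (∣∁p∣≡n∸∣p∣ T) ⟩
  (n ∸ ∣ T ∣) + (n ∸ ∣ T ∣)                        ≤⟨ +-monoʳ-≤ (n ∸ ∣ T ∣) n∸∣T∣≤∣T∣ ⟩
  (n ∸ ∣ T ∣) + ∣ T ∣                              ≡⟨ m∸n+n≡m (∣p∣≤n T) ⟩
  n                                                ∎)
  where
  open ≤-Reasoning
  T = tabulate c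
  n∸∣T∣≤∣T∣ : n ∸ ∣ T ∣ ≤ ∣ T ∣
  n∸∣T∣≤∣T∣ = m≤n+o⇒m∸n≤o n ∣ T ∣ (<⇒≤ (≰⇒> majority))

m*[1+n]+m*[1+n]≡m*2+m*2*n : ∀ m n → m * suc n + m * suc n ≡ m * 2 + m * 2 * n
m*[1+n]+m*[1+n]≡m*2+m*2*n = solve-∀

m*[1+n]≰k*β : ∀ {k m n β} .{{_ : NonZero k}} → k ≤ m * 2 → β + β ≤ n → ¬ (m * suc n ≤ k * β)
m*[1+n]≰k*β {k} {m} {n} {β} k≤m*2 β+β≤n m*[1+n]≤k*β = n≮0 (begin-strict
  0           <⟨ >-nonZero⁻¹ k ⟩
  k           ≤⟨ k≤m*2 ⟩
  m * 2       ≤⟨ +-cancelʳ-≤ (m * 2 * n) (m * 2) 0 m*2+m*2*n≤m*2*n ⟩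
  0           ∎)
  where
  open ≤-Reasoning
  m*2+m*2*n≤m*2*n : m * 2 + m * 2 * n ≤ m * 2 * n
  m*2+m*2*n≤m*2*n = begin
    m * 2 + m * 2 * n          ≡⟨ m*[1+n]+m*[1+n]≡m*2+m*2*n m n ⟨
    m * suc n + m * suc n      ≤⟨ +-mono-≤ m*[1+n]≤k*β m*[1+n]≤k*β ⟩
    k * β + k * β              ≡⟨ *-distribˡ-+ k β β ⟨
    k * (β + β)                ≤⟨ *-monoʳ-≤ k β+β≤n ⟩
    k * n                      ≤⟨ *-monoˡ-≤ n k≤m*2 ⟩
    m * 2 * n                  ∎

module RayEnds {n} (k : ℕ) (H : OrientedGraph n) (c : Fin n → Bool)
  (proper : ∀ u v → Arc H u v → c u ≢ c v) (semi : SemidegreeAbove H k) where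

  out : ∀ u → Σ (Fin n) (Arc H u)
  out u = outNeighbour k H (proj₁ (semi u))

  private
    module Out = Colouring H c proper
    module In = Colouring (H ᵒᵖ) c (λ u v e → proper v u e ∘ sym)

    -- outdeg (H ᵒᵖ) is definitionally indeg H, and outNbhd (H ᵒᵖ) is inNbhd H.
    inn : ∀ u → Σ (Fin n) (Arc (H ᵒᵖ) u)
    inn u = outNeighbour k (H ᵒᵖ) (proj₂ (semi u))

  ends : Fin n → Ray → Subset n
  ends v (forward s) = outNbhd H (Out.rayCentre out s v)
  ends v (backward s) = inNbhd H (In.rayCentre inn s v)

  rayWalk : ∀ v r {w} → w ∈ ends v r → Walk H (fwdSteps r) (bwdSteps r) v w
  rayWalk v (forward s) = Out.oddRay out s v
  rayWalk v (backward s) = fromᵒᵖ ∘ In.oddRay inn s v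

  ends-large : ∀ v r → n < k * ∣ ends v r ∣
  ends-large v (forward s) = proj₁ (semi _)
  ends-large v (backward s) = proj₂ (semi _)

  ends⊆class : ∀ {v} → c v ≡ false → ∀ r → ends v r ⊆ tabulate c
  ends⊆class {v} cv≡false (forward s) w∈ =
    ∈tabulate⁺ (trans (Out.oddRay-colour out s v w∈) (cong not cv≡false))
  ends⊆class {v} cv≡false (backward s) w∈ =
    ∈tabulate⁺ (trans (In.oddRay-colour inn s v w∈) (cong not cv≡false))

  closedWalk⊎count : ∀ {v} → c v ≡ false → ∀ L → AllPairs (Closable k) L →
    (Σ ℕ λ a → Σ ℕ λ b → (a ≢ b) × (a + b < k) × HasClosedWalk H a b)
    ⊎ length L * suc n ≤ k * ∣ tabulate c ∣
  closedWalk⊎count {v} cv≡false L closable with meet⊎∑∣S∣≤∣⋃S∣ (ends v) L closable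
  ... | inj₁ (r , r′ , (a≢b , a+b<k) , w , w∈) =
    let w∈r , w∈r′ = x∈p∩q⁻ (ends v r) (ends v r′) w∈
    in inj₁ (_ , _ , a≢b , a+b<k , v , rayWalk v r w∈r ++ʷ reverseʷ (rayWalk v r′ w∈r′))
  ... | inj₂ ∑≤∣⋃∣ = inj₂ (begin
    length L * suc n                      ≤⟨ length*1+m≤k*sum k (∣_∣ ∘ ends v) (ends-large v) L ⟩
    k * sum (map (∣_∣ ∘ ends v) L)        ≤⟨ *-monoʳ-≤ k ∑≤∣⋃∣ ⟩
    k * ∣ ⋃ (map (ends v) L) ∣            ≤⟨ *-monoʳ-≤ k (p⊆q⇒∣p∣≤∣q∣ (⋃-⊆ (ends v) (ends⊆class cv≡false) L)) ⟩
    k * ∣ tabulate c ∣                    ∎)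
    where open ≤-Reasoning

lemma2p9 : (k n : ℕ) → NonZero k → (¬ (2 ∣ k) ⊎ 4 ∣ k) → NonZero n →
    (H : OrientedGraph n) → Bipartite H → SemidegreeAbove H k →
    Σ ℕ λ a → Σ ℕ λ b → (a ≢ b) × (a + b < k) × HasClosedWalk H a b
lemma2p9 k (suc n) k≢0 _ _ H bipartite semi
  with c , proper , minority ← minorityColouring H bipartite
  with v , cv≡false ← Colouring.colour-exists H c proper (RayEnds.out k H c proper semi) Fin.zero false
  with RayEnds.closedWalk⊎count k H c proper semi cv≡false (rays ⌈ k /2⌉)
       (rays-closable {m = ⌈ k /2⌉} (⌈n/2⌉*2≤1+n k))
... | inj₁ closedWalk = closedWalk
... | inj₂ count = ⊥-elim (m*[1+n]≰k*β {m = ⌈ k /2⌉} {{k≢0}} (n≤⌈n/2⌉*2 k) minority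
        (subst (λ m → m * suc (suc n) ≤ k * ∣ tabulate c ∣) (length-rays ⌈ k /2⌉) count))
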